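{- Let $k$ and $n$ be positive integers with $k\le (n-3)/2$. Then every unbalanced signed complete graph of order $n$ contains a negative cycle of length $2k+1$.
   Context: A signed graph is a graph $G$ with a sign function $\sigma:E(G)\to\{+1,-1\}$; a signed complete graph of order $n$ is a signed graph whose underlying graph is $K_n$. The sign of a cycle is the product of the signs of its edges. A signed graph is balanced if it is switching equivalent to an all-positive signed graph (equivalently, all its cycles are positive), and unbalanced otherwise; switching at a vertex subset $U$ reverses the signs of all edges between $U$ and its complement. -}

module Defs where

open import Data.Nat using (ℕ; zero; suc; _+_; _*_)
open import Data.Bool using (Bool; true; false)
open import Data.Fin using (Fin; zero; suc; toℕ; fromℕ<)
open import Data.Nat.DivMod using (_%_; m%n<n)
open import Data.Product using (Σ; _×_; _,_)
open import Data.Empty using (⊥)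
open import Relation.Binary.PropositionalEquality using (_≡_; _≢_)
open import Function.Definitions using (Injective)
open import Relation.Nullary using (¬_)

data Sign : Set where
  pos neg : Sign

_·_ : Sign → Sign → Sign
pos · s = s
neg · pos = neg
neg · neg = pos

-- A signed complete graph of order n: the underlying graph is K_n on
-- vertex set Fin n; σ u v is the sign of the edge uv for u ≢ v
-- (values on the diagonal are irrelevant and never used).
record SignedCompleteGraph (n : ℕ) : Set where
  field
    σ    : Fin n → Fin n → Sign
    symm : ∀ u v → σ u v ≡ σ v u
open SignedCompleteGraph public

-- Switching at U ⊆ V (given by its indicator): flips the signs of all
-- edges between U and its complement.
flipIf : Bool → Sign → Sign
flipIf false s = s
flipIf true pos = neg
flipIf true neg = pos

xor : Bool → Bool → Bool
xor false b = b
xor true false = true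
xor true true = false

switchSign : ∀ {n} → (Fin n → Bool) → (Fin n → Fin n → Sign) → Fin n → Fin n → Sign
switchSign U s u v = flipIf (xor (U u) (U v)) (s u v)

Balanced : ∀ {n} → SignedCompleteGraph n → Set
Balanced {n} G = Σ (Fin n → Bool) λ U →
  ∀ (u v : Fin n) → u ≢ v → switchSign U (σ G) u v ≡ pos

Unbalanced : ∀ {n} → SignedCompleteGraph n → Set
Unbalanced G = ¬ Balanced G

next : ∀ {m} → Fin (suc m) → Fin (suc m)
next {m} i = fromℕ< (m%n<n (suc (toℕ i)) (suc m))

prodSign : ∀ {m} → (Fin m → Sign) → Sign
prodSign {zero} f = pos
prodSign {suc m} f = f zero · prodSign (λ i → f (suc i))

-- A cycle of length L = suc m in K_n, given by its cyclic sequence of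
-- distinct vertices c 0, c 1, ..., c m (edges c i — c (i+1 mod L)).
-- (Length ≥ 3 is imposed where used.)
Cycle : ℕ → ℕ → Set
Cycle n L = Σ (Fin L → Fin n) (Injective _≡_ _≡_)

cycleSign : ∀ {n m} → SignedCompleteGraph n → Cycle n (suc m) → Sign
cycleSign G (c , _) = prodSign (λ i → σ G (c i) (c (next i)))

HasNegativeCycleOfLength : ∀ {n} → SignedCompleteGraph n → (k : ℕ) → Set
HasNegativeCycleOfLength {n} G k =
  Σ (Cycle n (suc (2 * k))) λ C → cycleSign G C ≡ neg

module Submission where

-- Fix the pivot vertex 0 and let τ x y be the sign of the triangle 0 x y.
-- Unbalancedness yields a negative triangle 0 u v, i.e. τ u v negative;
-- and the cycle 0 x₁ … x₂ₖ 0 has the same sign as the walk x₁ … x₂ₖ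
-- measured by τ, since the signs of the edges at 0 cancel in pairs.
-- Starting from the walk u v, a negative τ-walk can be extended by any
-- two fresh vertices: one of four ways of inserting them keeps it
-- negative.  After k − 1 extensions we have 2k distinct vertices.

open import Defs
open import Data.Nat using (ℕ; zero; suc; _+_; _*_; _%_; _≤_; s≤s; z≤n)
open import Data.Nat.Properties
  using (suc-injective; *-comm; +-cancelˡ-≤; m<m+n; ≤-trans; m≤n⇒m⊓n≡m)
open import Data.Nat.DivMod using (m<n⇒m%n≡m; n%n≡0)
open import Data.Bool using (Bool; true; false)
open import Data.Fin using (Fin; toℕ; fromℕ; inject₁)
open import Data.Fin.Properties
  using (toℕ-injective; toℕ-fromℕ<; toℕ-fromℕ; toℕ-inject₁; toℕ<n; ¬∀⟶∃¬; all?)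
  renaming (_≟_ to _≟ᶠ_)
import Data.Fin.Properties as Finₚ
open import Data.List using (List; []; _∷_; length; lookup; take; tabulate)
open import Data.List.Properties using (length-take; length-tabulate)
open import Data.List.Membership.Propositional using (_∈_)
open import Data.List.Membership.Propositional.Properties using (∈-∃++; ∈-lookup; ∈-tabulate⁺)
open import Data.List.Relation.Unary.Any using (here; there)
import Data.List.Relation.Unary.All as All
open import Data.List.Relation.Unary.AllPairs using (_∷_)
open import Data.List.Relation.Unary.Unique.Propositional using (Unique)
open import Data.List.Relation.Unary.Unique.Propositional.Properties using (allFin⁺; take⁺)
open import Data.List.Relation.Binary.Permutation.Propositional
  using (_↭_; ↭-refl; ↭-prep; ↭-swap; ↭-trans; ↭-sym; ↭⇒↭ₛ)
open import Data.List.Relation.Binary.Permutation.Propositional.Properties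
  using (shift; shifts; ∈-resp-↭; ↭-length)
import Data.List.Relation.Binary.Permutation.Setoid.Properties as SetoidPermutation
open import Data.Product using (Σ; ∃; ∃₂; _×_; _,_)
open import Data.Sum using (_⊎_; inj₁; inj₂)
open import Data.Empty using (⊥-elim)
open import Function using (_∘_)
open import Relation.Binary.Definitions using (DecidableEquality)
open import Relation.Binary.PropositionalEquality
  using (_≡_; _≢_; refl; sym; trans; cong; cong₂; subst₂; setoid; module ≡-Reasoning)
open import Relation.Nullary using (Dec; yes; no; ¬?; _→-dec_)

private
  variable
    A : Set
    n : ℕ

·-identityʳ : ∀ s → s · pos ≡ s
·-identityʳ pos = refl
·-identityʳ neg = refl

·-assoc : ∀ r s t → (r · s) · t ≡ r · (s · t)
·-assoc pos s t = refl
·-assoc neg pos t = refl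
·-assoc neg neg pos = refl
·-assoc neg neg neg = refl

·-comm : ∀ s t → s · t ≡ t · s
·-comm s pos = ·-identityʳ s
·-comm pos neg = refl
·-comm neg neg = refl

·-inverse : ∀ s → s · s ≡ pos
·-inverse pos = refl
·-inverse neg = refl

·-cancelˡ : ∀ s t → s · (s · t) ≡ t
·-cancelˡ s t = trans (sym (·-assoc s s t)) (cong (_· t) (·-inverse s))

_≟ˢ_ : DecidableEquality Sign
pos ≟ˢ pos = yes refl
pos ≟ˢ neg = no λ ()
neg ≟ˢ pos = no λ ()
neg ≟ˢ neg = yes refl

≢pos⇒≡neg : ∀ {s} → s ≢ pos → s ≡ neg
≢pos⇒≡neg {pos} s≢pos = ⊥-elim (s≢pos refl)
≢pos⇒≡neg {neg} _ = refl

isNeg : Sign → Bool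
isNeg pos = false
isNeg neg = true

flipIf-xor-isNeg : ∀ r s t → flipIf (xor (isNeg r) (isNeg t)) s ≡ (r · s) · t
flipIf-xor-isNeg pos pos pos = refl
flipIf-xor-isNeg pos pos neg = refl
flipIf-xor-isNeg pos neg pos = refl
flipIf-xor-isNeg pos neg neg = refl
flipIf-xor-isNeg neg pos pos = refl
flipIf-xor-isNeg neg pos neg = refl
flipIf-xor-isNeg neg neg pos = refl
flipIf-xor-isNeg neg neg neg = refl

-- If r differs from both α and β, then α = β and the last two products
-- differ by the factor α · r = neg.
one-of-four-negative : ∀ r α β q →
  r · (β · neg) ≡ neg ⊎ r · (α · neg) ≡ neg ⊎ α · (β · q) ≡ neg ⊎ α · (r · q) ≡ neg
one-of-four-negative pos pos β q = inj₂ (inj₁ refl)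
one-of-four-negative neg neg β q = inj₂ (inj₁ refl)
one-of-four-negative pos neg pos q = inj₁ refl
one-of-four-negative neg pos neg q = inj₁ refl
one-of-four-negative pos neg neg pos = inj₂ (inj₂ (inj₂ refl))
one-of-four-negative pos neg neg neg = inj₂ (inj₂ (inj₁ refl))
one-of-four-negative neg pos pos pos = inj₂ (inj₂ (inj₂ refl))
one-of-four-negative neg pos pos neg = inj₂ (inj₂ (inj₁ refl))

walkSign : (A → A → Sign) → List A → Sign
walkSign σ [] = pos
walkSign σ (x ∷ []) = pos
walkSign σ (x ∷ y ∷ xs) = σ x y · walkSign σ (y ∷ xs)

walkEnd : A → List A → A
walkEnd x [] = x
walkEnd x (y ∷ xs) = walkEnd y xs

closedWalkSign : (A → A → Sign) → A → List A → Sign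
closedWalkSign σ x xs = walkSign σ (x ∷ xs) · σ (walkEnd x xs) x

-- With f = σ p, switchedBy f σ x y is the sign of the triangle p x y.
switchedBy : (A → Sign) → (A → A → Sign) → A → A → Sign
switchedBy f σ x y = (f x · σ x y) · f y

switchedBy-sym : ∀ f {σ : A → A → Sign} → (∀ x y → σ x y ≡ σ y x) →
  ∀ x y → switchedBy f σ x y ≡ switchedBy f σ y x
switchedBy-sym f {σ} σ-sym x y = begin
  (f x · σ x y) · f y   ≡⟨ ·-comm (f x · σ x y) (f y) ⟩
  f y · (f x · σ x y)   ≡⟨ cong (f y ·_) (·-comm (f x) (σ x y)) ⟩
  f y · (σ x y · f x)   ≡⟨ sym (·-assoc (f y) (σ x y) (f x)) ⟩
  (f y · σ x y) · f x   ≡⟨ cong (λ s → (f y · s) · f x) (σ-sym x y) ⟩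
  (f y · σ y x) · f x   ∎
  where open ≡-Reasoning

switchSign-isNeg : ∀ (f : Fin n → Sign) σ x y →
  switchSign (isNeg ∘ f) σ x y ≡ switchedBy f σ x y
switchSign-isNeg f σ x y = flipIf-xor-isNeg (f x) (σ x y) (f y)

walkSign-switchedBy : ∀ f (σ : A → A → Sign) x xs →
  walkSign (switchedBy f σ) (x ∷ xs) ≡ (f x · walkSign σ (x ∷ xs)) · f (walkEnd x xs)
walkSign-switchedBy f σ x [] = sym (trans (cong (_· f x) (·-identityʳ (f x))) (·-inverse (f x)))
walkSign-switchedBy f σ x (y ∷ xs) = begin
  ((f x · σ x y) · f y) · walkSign (switchedBy f σ) (y ∷ xs)
    ≡⟨ cong (((f x · σ x y) · f y) ·_) (walkSign-switchedBy f σ y xs) ⟩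
  ((f x · σ x y) · f y) · ((f y · w) · e)
    ≡⟨ ·-assoc (f x · σ x y) (f y) ((f y · w) · e) ⟩
  (f x · σ x y) · (f y · ((f y · w) · e))
    ≡⟨ cong ((f x · σ x y) ·_) (trans (cong (f y ·_) (·-assoc (f y) w e)) (·-cancelˡ (f y) (w · e))) ⟩
  (f x · σ x y) · (w · e)
    ≡⟨ ·-assoc (f x) (σ x y) (w · e) ⟩
  f x · (σ x y · (w · e))
    ≡⟨ cong (f x ·_) (sym (·-assoc (σ x y) w e)) ⟩
  f x · ((σ x y · w) · e)
    ≡⟨ sym (·-assoc (f x) (σ x y · w) e) ⟩
  (f x · (σ x y · w)) · e ∎
  where
  open ≡-Reasoning
  w = walkSign σ (y ∷ xs)
  e = f (walkEnd y xs)

closedWalkSign-pivot : ∀ {σ : A → A → Sign} → (∀ x y → σ x y ≡ σ y x) →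
  ∀ p x xs → closedWalkSign σ p (x ∷ xs) ≡ walkSign (switchedBy (σ p) σ) (x ∷ xs)
closedWalkSign-pivot {σ = σ} σ-sym p x xs =
  trans (cong ((σ p x · walkSign σ (x ∷ xs)) ·_) (σ-sym (walkEnd x xs) p))
        (sym (walkSign-switchedBy (σ p) σ x xs))

module _ {τ : A → A → Sign} (τ-sym : ∀ x y → τ x y ≡ τ y x) where

  insert-pair-negative : ∀ a b ys → walkSign τ ys ≡ neg →
    ∃ λ zs → zs ↭ a ∷ b ∷ ys × walkSign τ zs ≡ neg
  insert-pair-negative a b (y ∷ z ∷ rest) yz-neg
    with one-of-four-negative (τ a b) (τ a y) (τ b y) (τ b z · walkSign τ (z ∷ rest))
  ... | inj₁ e = a ∷ b ∷ y ∷ z ∷ rest , ↭-refl ,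
    trans (cong (λ w → τ a b · (τ b y · w)) yz-neg) e
  ... | inj₂ (inj₁ e) = b ∷ a ∷ y ∷ z ∷ rest , ↭-swap b a ↭-refl ,
    trans (cong₂ (λ r w → r · (τ a y · w)) (τ-sym b a) yz-neg) e
  ... | inj₂ (inj₂ (inj₁ e)) = a ∷ y ∷ b ∷ z ∷ rest , ↭-prep a (↭-swap y b ↭-refl) ,
    trans (cong (λ s → τ a y · (s · walkSign τ (b ∷ z ∷ rest))) (τ-sym y b)) e
  ... | inj₂ (inj₂ (inj₂ e)) = y ∷ a ∷ b ∷ z ∷ rest ,
    ↭-trans (↭-swap y a ↭-refl) (↭-prep a (↭-swap y b ↭-refl)) ,
    trans (cong (_· walkSign τ (a ∷ b ∷ z ∷ rest)) (τ-sym y a)) e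

  negativeWalk : ∀ {u v} → τ u v ≡ neg → ∀ t (xs : List A) → length xs ≡ t * 2 →
    ∃ λ ys → ys ↭ u ∷ v ∷ xs × walkSign τ ys ≡ neg
  negativeWalk {u} {v} uv-neg zero [] _ = u ∷ v ∷ [] , ↭-refl , trans (·-identityʳ (τ u v)) uv-neg
  negativeWalk {u} {v} uv-neg (suc t) (c ∷ d ∷ xs) eq
    with ys , ys↭ , ys-neg ← negativeWalk uv-neg t xs (suc-injective (suc-injective eq))
    with zs , zs↭ , zs-neg ← insert-pair-negative c d ys ys-neg
    = zs , ↭-trans zs↭ (↭-trans (↭-prep c (↭-prep d ys↭)) (shifts (c ∷ d ∷ []) (u ∷ v ∷ []))) , zs-neg

Unique-resp-↭ : {xs ys : List A} → xs ↭ ys → Unique xs → Unique ys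
Unique-resp-↭ p = SetoidPermutation.Unique-resp-↭ (setoid _) (↭⇒↭ₛ p)

lookup-injective : {xs : List A} → Unique xs → ∀ {i j} → lookup xs i ≡ lookup xs j → i ≡ j
lookup-injective (x∉xs ∷ _) {Fin.zero} {Fin.zero} _ = refl
lookup-injective (x∉xs ∷ _) {Fin.zero} {Fin.suc j} e = ⊥-elim (All.lookup x∉xs (∈-lookup j) e)
lookup-injective (x∉xs ∷ _) {Fin.suc i} {Fin.zero} e = ⊥-elim (All.lookup x∉xs (∈-lookup i) (sym e))
lookup-injective (_ ∷ distinct) {Fin.suc i} {Fin.suc j} e = cong Fin.suc (lookup-injective distinct e)

∈⇒↭-front : {x : A} {xs : List A} → x ∈ xs → ∃ λ ys → xs ↭ x ∷ ys
∈⇒↭-front {x = x} x∈xs with ys , zs , refl ← ∈-∃++ x∈xs = _ , shift x ys zs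

∈⇒↭-front₂ : {x y : A} {xs : List A} → x ∈ xs → y ∈ xs → x ≢ y → ∃ λ ys → xs ↭ x ∷ y ∷ ys
∈⇒↭-front₂ {x = x} x∈xs y∈xs x≢y with ys , xs↭ ← ∈⇒↭-front x∈xs with ∈-resp-↭ xs↭ y∈xs
... | here y≡x = ⊥-elim (x≢y (sym y≡x))
... | there y∈ys with zs , ys↭ ← ∈⇒↭-front y∈ys = zs , ↭-trans xs↭ (↭-prep x ys↭)

prodSign-inject₁ : ∀ m (h : Fin (suc m) → Sign) →
  prodSign h ≡ prodSign (h ∘ inject₁) · h (fromℕ m)
prodSign-inject₁ zero h = ·-identityʳ (h Fin.zero)
prodSign-inject₁ (suc m) h =
  trans (cong (h Fin.zero ·_) (prodSign-inject₁ m (h ∘ Fin.suc)))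
        (sym (·-assoc (h Fin.zero) (prodSign (h ∘ Fin.suc ∘ inject₁)) (h (Fin.suc (fromℕ m)))))

next-inject₁ : ∀ {m} (i : Fin m) → next (inject₁ i) ≡ Fin.suc i
next-inject₁ {m} i = toℕ-injective (trans (toℕ-fromℕ< _)
  (trans (cong (λ j → suc j % suc m) (toℕ-inject₁ i)) (m<n⇒m%n≡m (s≤s (toℕ<n i)))))

next-fromℕ : ∀ m → next (fromℕ m) ≡ Fin.zero
next-fromℕ m = toℕ-injective (trans (toℕ-fromℕ< _)
  (trans (cong (λ j → suc j % suc m) (toℕ-fromℕ m)) (n%n≡0 (suc m))))

prodSign-lookup≡walkSign : ∀ (σ : A → A → Sign) x xs →
  prodSign (λ i → σ (lookup (x ∷ xs) (inject₁ i)) (lookup xs i)) ≡ walkSign σ (x ∷ xs)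
prodSign-lookup≡walkSign σ x [] = refl
prodSign-lookup≡walkSign σ x (y ∷ ys) = cong (σ x y ·_) (prodSign-lookup≡walkSign σ y ys)

lookup-fromℕ≡walkEnd : ∀ (x : A) xs → lookup (x ∷ xs) (fromℕ (length xs)) ≡ walkEnd x xs
lookup-fromℕ≡walkEnd x [] = refl
lookup-fromℕ≡walkEnd x (y ∷ ys) = lookup-fromℕ≡walkEnd y ys

cycleOfList : (G : SignedCompleteGraph n) → ∀ x xs → Unique (x ∷ xs) →
  Σ (Cycle n (suc (length xs))) λ C → cycleSign G C ≡ closedWalkSign (σ G) x xs
cycleOfList G x xs distinct = (c , lookup-injective distinct) , (begin
  prodSign (λ i → σ G (c i) (c (next i)))
    ≡⟨ prodSign-inject₁ m (λ i → σ G (c i) (c (next i))) ⟩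
  prodSign (λ i → σ G (c (inject₁ i)) (c (next (inject₁ i)))) · σ G (c (fromℕ m)) (c (next (fromℕ m)))
    ≡⟨ cong₂ _·_ (trans (prodSign-cong λ i → cong (σ G (c (inject₁ i)) ∘ c) (next-inject₁ i))
                        (prodSign-lookup≡walkSign (σ G) x xs))
                 (cong₂ (σ G) (lookup-fromℕ≡walkEnd x xs) (cong c (next-fromℕ m))) ⟩
  closedWalkSign (σ G) x xs ∎)
  where
  open ≡-Reasoning
  m = length xs
  c = lookup (x ∷ xs)
  prodSign-cong : ∀ {k} {f g : Fin k → Sign} → (∀ i → f i ≡ g i) → prodSign f ≡ prodSign g
  prodSign-cong {zero} f≗g = refl
  prodSign-cong {suc k} f≗g = cong₂ _·_ (f≗g Fin.zero) (prodSign-cong (f≗g ∘ Fin.suc))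

module Pivot {N : ℕ} (G : SignedCompleteGraph (suc N)) where

  triangleSign : Fin (suc N) → Fin (suc N) → Sign
  triangleSign = switchedBy (σ G Fin.zero) (σ G)

  -- The switching that makes every edge at 0 positive.
  pivotSign : Fin (suc N) → Sign
  pivotSign Fin.zero = pos
  pivotSign (Fin.suc x) = σ G Fin.zero (Fin.suc x)

  balanced-if-triangles-positive :
    (∀ x y → x ≢ y → triangleSign (Fin.suc x) (Fin.suc y) ≡ pos) → Balanced G
  balanced-if-triangles-positive positive = isNeg ∘ pivotSign , λ x y x≢y →
    trans (switchSign-isNeg pivotSign (σ G) x y) (switched x y x≢y)
    where
    switched : ∀ x y → x ≢ y → switchedBy pivotSign (σ G) x y ≡ pos
    switched Fin.zero Fin.zero 0≢0 = ⊥-elim (0≢0 refl)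
    switched Fin.zero (Fin.suc y) _ = ·-inverse (σ G Fin.zero (Fin.suc y))
    switched (Fin.suc x) Fin.zero _ =
      trans (·-identityʳ (σ0x · σ G (Fin.suc x) Fin.zero))
            (trans (cong (σ0x ·_) (symm G (Fin.suc x) Fin.zero)) (·-inverse σ0x))
      where σ0x = σ G Fin.zero (Fin.suc x)
    switched (Fin.suc x) (Fin.suc y) sx≢sy = positive x y (sx≢sy ∘ cong Fin.suc)

  positive? : ∀ x y → Dec (x ≢ y → triangleSign (Fin.suc x) (Fin.suc y) ≡ pos)
  positive? x y = ¬? (x ≟ᶠ y) →-dec (triangleSign (Fin.suc x) (Fin.suc y) ≟ˢ pos)

  negativeTriangle : Unbalanced G →
    ∃₂ λ x y → x ≢ y × triangleSign (Fin.suc x) (Fin.suc y) ≡ neg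
  negativeTriangle unbalanced
    with x , ¬∀y ← ¬∀⟶∃¬ N _ (λ x → all? λ y → positive? x y)
                             (unbalanced ∘ balanced-if-triangles-positive)
    with y , ¬[x≢y⇒pos] ← ¬∀⟶∃¬ N _ (positive? x) ¬∀y
    = x , y , (λ x≡y → ¬[x≢y⇒pos] λ x≢y → ⊥-elim (x≢y x≡y)) , ≢pos⇒≡neg λ e → ¬[x≢y⇒pos] λ _ → e

negativeCycleThrough : (G : SignedCompleteGraph n) → ∀ p xs {m} → Unique (p ∷ xs) → length xs ≡ m →
  walkSign (switchedBy (σ G p) (σ G)) xs ≡ neg → Σ (Cycle n (suc m)) λ C → cycleSign G C ≡ neg
negativeCycleThrough G p (x ∷ xs) distinct refl walk-neg =
  let C , C-sign = cycleOfList G p (x ∷ xs) distinct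
  in C , trans C-sign (trans (closedWalkSign-pivot (symm G) p x xs) walk-neg)

length-take-≤ : ∀ {m} {xs : List A} → m ≤ length xs → length (take m xs) ≡ m
length-take-≤ {m = m} {xs} m≤∣xs∣ = trans (length-take m xs) (m≤n⇒m⊓n≡m m≤∣xs∣)

unbalanced⇒negativeOddCycle : ∀ {k n} → 1 ≤ k → suc (2 * k) ≤ n →
  (G : SignedCompleteGraph n) → Unbalanced G → HasNegativeCycleOfLength G k
unbalanced⇒negativeOddCycle {suc t} {suc N} _ (s≤s 2k≤N) G unbalanced =
  let u , v , u≢v , uv-neg = negativeTriangle unbalanced
      rest , front = ∈⇒↭-front₂ (∈-tabulate⁺ u) (∈-tabulate⁺ v) (u≢v ∘ Finₚ.suc-injective)
      room : t * 2 ≤ length rest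
      room = +-cancelˡ-≤ 2 (t * 2) (length rest)
        (subst₂ _≤_ (*-comm 2 (suc t)) (trans (sym (length-tabulate Fin.suc)) (↭-length front)) 2k≤N)
      P , P↭ , P-neg = negativeWalk (switchedBy-sym (σ G Fin.zero) (symm G)) uv-neg
                                    t (take (t * 2) rest) (length-take-≤ room)
      -- allFin (suc N) is definitionally Fin.zero ∷ tabulate Fin.suc.
      distinct : Unique (Fin.zero ∷ P)
      distinct = Unique-resp-↭ (↭-prep Fin.zero (↭-sym P↭))
                   (take⁺ (3 + t * 2) (Unique-resp-↭ (↭-prep Fin.zero front) (allFin⁺ (suc N))))
  in negativeCycleThrough G Fin.zero P distinct
       (trans (↭-length P↭) (trans (cong (2 +_) (length-take-≤ room)) (*-comm (suc t) 2))) P-neg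
  where open Pivot G

lemma2p3 : (k n : ℕ) → 1 ≤ k → 1 ≤ n → 2 * k + 3 ≤ n →
    (G : SignedCompleteGraph n) → Unbalanced G → HasNegativeCycleOfLength G k
lemma2p3 k n 1≤k _ 2k+3≤n = unbalanced⇒negativeOddCycle 1≤k (≤-trans (m<m+n (2 * k) (s≤s z≤n)) 2k+3≤n)
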